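{- Let $\mathcal{C}$ be a permutation class containing $12$ and $21$. Let $t=\pi[\mathcal{D}_1,\dots,\mathcal{D}_n]$ be a restriction term (with $\pi$ simple of size $n$, or $\pi\in\{\oplus,\ominus\}$ and $n=2$), where $\mathcal{D}_i=\hat{\mathcal{C}}^{\delta_i}\langle E_i\rangle(A_i)$ with $E_i,A_i$ finite and disjoint, and let $m=\sum_{i=1}^n(|E_i|+|A_i|)$. Then $\overline{t}$ is the disjoint union of the $2^m-1$ restriction terms $\pi[\mathcal{D}'_1,\dots,\mathcal{D}'_n]$ such that for all $i$, $\mathcal{D}'_i=\hat{\mathcal{C}}^{\delta_i}\langle E'_i\rangle(A'_i)$ with $(E'_i,A'_i)$ a pair of disjoint sets satisfying $E'_i\cup A'_i=E_i\cup A_i$, and there exists $i$ with $(E'_i,A'_i)\neq(E_i,A_i)$.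
   Context: Permutations, patterns, containment and avoidance as usual; a permutation class is a pattern-closed set of permutations of size $\ge1$. Simple: size $\ge4$ with only trivial intervals. Substitution $\sigma[\pi^1,\dots,\pi^n]$ inflates the $i$-th entry of $\sigma$ into a block of consecutive values order-isomorphic to $\pi^i$; $\oplus=12$, $\ominus=21$; $\pi[\mathcal{D}_1,\dots,\mathcal{D}_n]=\{\pi[\sigma_1,\dots,\sigma_n]:\sigma_i\in\mathcal{D}_i\}$. $\hat{\mathcal{C}}$ is the substitution closure of $\mathcal{C}$; $\mathcal{A}^+$ (resp. $\mathcal{A}^-$) is the set of elements of $\mathcal{A}$ not of the form $\oplus[\pi^1,\pi^2]$ (resp. $\ominus[\pi^1,\pi^2]$); $\hat{\mathcal{C}}^\delta$ for $\delta\in\{\,\cdot\,,+,-\}$ is $\hat{\mathcal{C}},\hat{\mathcal{C}}^+,\hat{\mathcal{C}}^-$. $\mathcal{P}\langle E\rangle(A)$: elements of $\mathcal{P}$ avoiding all of $E$ and containing all of $A$; such sets with $\mathcal{P}=\hat{\mathcal{C}}^\delta$ are restrictions. A restriction term is $\pi[\mathcal{D}_1,\dots,\mathcal{D}_n]$ with $\pi$ simple and each $\mathcal{D}_i$ a restriction of $\hat{\mathcal{C}}$ (i.e. $\delta_i=\cdot$), or $\oplus[\mathcal{D}_1,\mathcal{D}_2]$ with $\mathcal{D}_1$ a restriction of $\hat{\mathcal{C}}^+$ and $\mathcal{D}_2$ of $\hat{\mathcal{C}}$, or $\ominus[\mathcal{D}_1,\mathcal{D}_2]$ with $\mathcal{D}_1$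 a restriction of $\hat{\mathcal{C}}^-$ and $\mathcal{D}_2$ of $\hat{\mathcal{C}}$. The complement $\overline{t}$ is $\pi[\hat{\mathcal{C}},\dots,\hat{\mathcal{C}}]\setminus t$ for $\pi$ simple, $\oplus[\hat{\mathcal{C}}^+,\hat{\mathcal{C}}]\setminus t$ for $\pi=\oplus$, and $\ominus[\hat{\mathcal{C}}^-,\hat{\mathcal{C}}]\setminus t$ for $\pi=\ominus$. -}

module Defs where

open import Data.Nat using (ℕ; zero; suc; _+_; _≤_; _<_; _<?_; _<ᵇ_)
open import Data.Bool using (if_then_else_)
open import Data.List using (List; []; _∷_; map; concat; zipWith; zip; length; filter; take; drop; upTo; replicate)
open import Data.Nat.ListAction using (sum)
open import Data.List.Relation.Unary.All using (All)
open import Data.List.Relation.Unary.Any using (Any)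
open import Data.List.Relation.Binary.Pointwise using (Pointwise)
open import Data.List.Relation.Binary.Sublist.Propositional using (_⊆_)
open import Data.List.Relation.Binary.Permutation.Propositional using (_↭_)
open import Data.List.Membership.Propositional using (_∈_)
open import Data.Product using (Σ; ∃; _×_; _,_; proj₁; proj₂)
open import Data.Sum using (_⊎_)
open import Data.Empty using (⊥)
open import Relation.Nullary using (¬_)
open import Relation.Binary.PropositionalEquality using (_≡_)
open import Function.Bundles using (_⇔_)

-- Permutations are one-line notations: lists of naturals that are a
-- rearrangement of 0,1,…,n-1 (n = length).

Perm : Set
Perm = List ℕ

IsPerm : Perm → Set
IsPerm σ = σ ↭ upTo (length σ)

st : List ℕ → List ℕ
st xs = map (λ x → length (filter (_<? x) xs)) xs

_≼_ : Perm → Perm → Set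
τ ≼ σ = ∃ λ sub → (sub ⊆ σ) × (st sub ≡ τ)

IsClass : (Perm → Set) → Set
IsClass C = (∀ σ → C σ → IsPerm σ × 1 ≤ length σ)
          × (∀ σ τ → C σ → IsPerm τ → 1 ≤ length τ → τ ≼ σ → C τ)

-- Substitution σ[π¹,…,πⁿ]  (requires length πs ≡ length σ)

offset : Perm → List Perm → ℕ → ℕ
offset σ πs s = sum (zipWith (λ s' p → if s' <ᵇ s then length p else 0) σ πs)

inflate : Perm → List Perm → Perm
inflate σ πs = concat (zipWith (λ s p → map (offset σ πs s +_) p) σ πs)

⊕perm ⊖perm : Perm
⊕perm = 0 ∷ 1 ∷ []
⊖perm = 1 ∷ 0 ∷ []

Contiguous : List ℕ → Set
Contiguous w = ∃ λ a → All (λ x → a ≤ x × x < a + length w) w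

Simple : Perm → Set
Simple σ = IsPerm σ × 4 ≤ length σ
         × (∀ i k → 2 ≤ k → k < length σ → i + k ≤ length σ → ¬ Contiguous (take k (drop i σ)))

data Ĉ (C : Perm → Set) : Perm → Set where
  base : ∀ {σ} → C σ → Ĉ C σ
  subst : ∀ {σ πs} → Ĉ C σ → length πs ≡ length σ → All (Ĉ C) πs → Ĉ C (inflate σ πs)

NonEmptyPerm : Perm → Set
NonEmptyPerm p = IsPerm p × 1 ≤ length p

SumDec : Perm → Set
SumDec σ = ∃ λ p₁ → ∃ λ p₂ → NonEmptyPerm p₁ × NonEmptyPerm p₂ × σ ≡ inflate ⊕perm (p₁ ∷ p₂ ∷ [])

SkewDec : Perm → Set
SkewDec σ = ∃ λ p₁ → ∃ λ p₂ → NonEmptyPerm p₁ × NonEmptyPerm p₂ × σ ≡ inflate ⊖perm (p₁ ∷ p₂ ∷ [])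

data Sign : Set where
  · + - : Sign

Ĉδ : (Perm → Set) → Sign → Perm → Set
Ĉδ C · σ = Ĉ C σ
Ĉδ C + σ = Ĉ C σ × ¬ SumDec σ
Ĉδ C - σ = Ĉ C σ × ¬ SkewDec σ

Restr : (Perm → Set) → Sign → List Perm → List Perm → Perm → Set
Restr C δ E A σ = Ĉδ C δ σ × All (λ e → ¬ (e ≼ σ)) E × All (λ a → a ≼ σ) A

data Shape : Set where
  simple : (π : Perm) → Simple π → Shape
  ⊕s ⊖s : Shape

shapePerm : Shape → Perm
shapePerm (simple π _) = π
shapePerm ⊕s = ⊕perm
shapePerm ⊖s = ⊖perm

arity : Shape → ℕ
arity s = length (shapePerm s)

signs : Shape → List Sign
signs (simple π _) = replicate (length π) ·
signs ⊕s = + ∷ · ∷ []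
signs ⊖s = - ∷ · ∷ []

Spec : Set
Spec = List (List Perm × List Perm)

RestrAt : (Perm → Set) → Sign × (List Perm × List Perm) → Perm → Set
RestrAt C δEA p = Restr C (proj₁ δEA) (proj₁ (proj₂ δEA)) (proj₂ (proj₂ δEA)) p

Term : (Perm → Set) → Shape → Spec → Perm → Set
Term C s spec σ = ∃ λ πs → Pointwise (RestrAt C) (zip (signs s) spec) πs
                          × σ ≡ inflate (shapePerm s) πs

BaseTerm : (Perm → Set) → Shape → Perm → Set
BaseTerm C s σ = ∃ λ πs → Pointwise (Ĉδ C) (signs s) πs × σ ≡ inflate (shapePerm s) πs

Complement : (Perm → Set) → Shape → Spec → Perm → Set
Complement C s spec σ = BaseTerm C s σ × ¬ Term C s spec σ

-- finite sets of permutations, as lists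

Disjoint : List Perm → List Perm → Set
Disjoint E A = ∀ x → x ∈ E → x ∈ A → ⊥

SameSet : List Perm → List Perm → Set
SameSet X Y = ∀ x → (x ∈ X) ⇔ (x ∈ Y)

WellFormedEA : List Perm × List Perm → Set
WellFormedEA EA = All IsPerm (proj₁ EA) × All IsPerm (proj₂ EA) × Disjoint (proj₁ EA) (proj₂ EA)

SplitOf : List Perm × List Perm → List Perm × List Perm → Set
SplitOf EA EA' = Disjoint (proj₁ EA') (proj₂ EA')
               × (∀ x → (x ∈ proj₁ EA' ⊎ x ∈ proj₂ EA') ⇔ (x ∈ proj₁ EA ⊎ x ∈ proj₂ EA))

SamePair : List Perm × List Perm → List Perm × List Perm → Set
SamePair EA EA' = SameSet (proj₁ EA) (proj₁ EA') × SameSet (proj₂ EA) (proj₂ EA')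

DiffPair : (List Perm × List Perm) × (List Perm × List Perm) → Set
DiffPair p = ¬ SamePair (proj₁ p) (proj₂ p)

IsSplit : Spec → Spec → Set
IsSplit spec spec' = Pointwise SplitOf spec spec'

Differs : Spec → Spec → Set
Differs spec spec' = Any DiffPair (zip spec spec')

SameSpec : Spec → Spec → Set
SameSpec spec' spec'' = Pointwise SamePair spec' spec''

module Submission where

-- Two facts carry the proof.  (1) A permutation τ satisfies exactly one
-- split (E', A') of a finite set of patterns: E' must be the patterns τ
-- avoids and A' those it contains (pattern containment is decidable).
-- (2) Uniqueness of decomposition: if π[α₁,…,αₙ] = π[β₁,…,βₙ] with αᵢ, βᵢ in
-- Ĉ^{δᵢ}, then αᵢ = βᵢ.  For ⊕ (⊖) this is forced by the first block being
-- sum (skew) indecomposable.  For simple π, both sides carry a block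
-- structure over π; at the first block where the two structures disagree,
-- the longer block is an interval of σ containing the starts of several
-- consecutive shorter blocks, which then form a proper interval of π.

open import Defs hiding (+; -; ·)
import Defs as D
open import Data.Bool using (true; false; T; if_then_else_)
open import Data.Unit using (tt)
open import Data.Nat using (ℕ; zero; suc; _+_; _∸_; _≤_; _<_; _<ᵇ_; _≤?_; _<?_; z≤n; s≤s; z<s; s<s)
open import Data.Nat.Properties
open import Data.Nat.ListAction using (sum)
open import Data.Fin using (Fin; toℕ; fromℕ<)
import Data.Fin.Properties as Fin
open import Data.List using (List; []; _∷_; map; _++_; length; upTo; take; drop; concat; zip; zipWith; filter; replicate)
import Data.List.Properties as List
open import Data.List.Relation.Binary.Sublist.Propositional using (_⊆_; []; _∷_; _∷ʳ_)
open import Data.List.Membership.Propositional using (_∈_; find; lose)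
open import Data.List.Membership.Propositional.Properties
  using (∈-++⁺ˡ; ∈-++⁺ʳ; ∈-++⁻; ∈-map⁺; ∈-map⁻; ∈-upTo⁺; ∈-upTo⁻; ∈-filter⁺; ∈-filter⁻)
open import Data.List.Membership.DecPropositional _≟_ using (_∈?_)
open import Data.List.Membership.Propositional.Properties.WithK using (unique∧set⇒bag)
open import Data.List.Relation.Unary.Any using (here; there; any?)
open import Data.List.Relation.Unary.All as All using (All; []; _∷_; all?)
open import Data.List.Relation.Unary.All.Properties using (all-filter)
open import Data.List.Relation.Unary.AllPairs using ([]; _∷_)
open import Data.List.Relation.Unary.Unique.Propositional using (Unique)
open import Data.List.Relation.Unary.Unique.Propositional.Properties using (upTo⁺; take⁺; drop⁺)
open import Data.List.Relation.Binary.Pointwise as Pointwise using (Pointwise; []; _∷_; Pointwise-length)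
open import Data.List.Relation.Binary.Permutation.Propositional using (↭-sym; ↭⇒↭ₛ)
open import Data.List.Relation.Binary.Permutation.Propositional.Properties using (∈-resp-↭)
import Data.List.Relation.Binary.Permutation.Setoid.Properties as PermSetoid
open import Data.List.Relation.Binary.BagAndSetEquality using (∼bag⇒↭)
open import Data.Product using (∃; _×_; _,_; proj₁; proj₂)
open import Data.Sum using (_⊎_; inj₁; inj₂)
open import Data.Empty using (⊥; ⊥-elim)
open import Relation.Nullary using (Dec; yes; no; ¬_; ¬?; _×-dec_)
open import Relation.Binary.Definitions using (tri<; tri≈; tri>)
open import Relation.Binary.PropositionalEquality as Eq using (_≡_; _≢_; refl; sym; cong; cong₂; setoid)
open import Function.Bundles using (_⇔_; mk⇔; Equivalence)
import Function.Properties.Equivalence as ⇔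
open Equivalence using (to)

module PatternContainment where

  sublists : List ℕ → List (List ℕ)
  sublists [] = [] ∷ []
  sublists (x ∷ xs) = map (x ∷_) (sublists xs) ++ sublists xs

  sublists-sound : ∀ xs {s} → s ∈ sublists xs → s ⊆ xs
  sublists-sound [] (here refl) = []
  sublists-sound (x ∷ xs) s∈ with ∈-++⁻ (map (x ∷_) (sublists xs)) s∈
  ... | inj₂ s∈rest = x ∷ʳ sublists-sound xs s∈rest
  ... | inj₁ s∈cons with ∈-map⁻ (x ∷_) s∈cons
  ...   | t , t∈ , refl = refl ∷ sublists-sound xs t∈

  sublists-complete : ∀ xs {s} → s ⊆ xs → s ∈ sublists xs
  sublists-complete [] [] = here refl
  sublists-complete (x ∷ xs) (.x ∷ʳ s⊆) = ∈-++⁺ʳ (map (x ∷_) (sublists xs)) (sublists-complete xs s⊆)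
  sublists-complete (x ∷ xs) (refl ∷ s⊆) = ∈-++⁺ˡ (∈-map⁺ (x ∷_) (sublists-complete xs s⊆))

  _≼?_ : (τ σ : Perm) → Dec (τ ≼ σ)
  τ ≼? σ with any? (λ s → List.≡-dec _≟_ (st s) τ) (sublists σ)
  ... | yes found with find found
  ...   | s , s∈ , eq = yes (s , sublists-sound σ s∈ , eq)
  τ ≼? σ | no none = no λ { (s , s⊆ , eq) → none (lose (sublists-complete σ s⊆) eq) }

-- Positional reasoning: a list of naturals read as a function on
-- positions, with default value outside its length.
module Positions where

  ix : {A : Set} → A → List A → ℕ → A
  ix d [] _ = d
  ix d (x ∷ xs) zero = x
  ix d (x ∷ xs) (suc i) = ix d xs i

  at : List ℕ → ℕ → ℕ
  at = ix 0

  Inj : List ℕ → Set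
  Inj w = ∀ x y → x < length w → y < length w → at w x ≡ at w y → x ≡ y

  All⇒ix : ∀ {A : Set} {P : A → Set} d (xs : List A) → All P xs → ∀ i → i < length xs → P (ix d xs i)
  All⇒ix d (x ∷ xs) (p ∷ ps) zero _ = p
  All⇒ix d (x ∷ xs) (p ∷ ps) (suc i) (s≤s i<) = All⇒ix d xs ps i i<

  ix⇒All : ∀ {A : Set} {P : A → Set} d (xs : List A) → (∀ i → i < length xs → P (ix d xs i)) → All P xs
  ix⇒All d [] f = []
  ix⇒All d (x ∷ xs) f = f 0 z<s ∷ ix⇒All d xs (λ i i< → f (suc i) (s<s i<))

  ∈⇒ix : ∀ {A : Set} d (xs : List A) {y} → y ∈ xs → ∃ λ i → i < length xs × ix d xs i ≡ y
  ∈⇒ix d (x ∷ xs) (here refl) = 0 , z<s , refl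
  ∈⇒ix d (x ∷ xs) (there y∈) with ∈⇒ix d xs y∈
  ... | i , i< , eq = suc i , s<s i< , eq

  ix⇒∈ : ∀ {A : Set} d (xs : List A) i → i < length xs → ix d xs i ∈ xs
  ix⇒∈ d (x ∷ xs) zero _ = here refl
  ix⇒∈ d (x ∷ xs) (suc i) (s≤s i<) = there (ix⇒∈ d xs i i<)

  unique⇒inj : ∀ w → Unique w → Inj w
  unique⇒inj (x ∷ w) (x∉ ∷ u) zero zero _ _ _ = refl
  unique⇒inj (x ∷ w) (x∉ ∷ u) zero (suc y) _ (s≤s y<) eq = ⊥-elim (All⇒ix 0 w x∉ y y< eq)
  unique⇒inj (x ∷ w) (x∉ ∷ u) (suc x') zero (s≤s x<) _ eq = ⊥-elim (All⇒ix 0 w x∉ x' x< (sym eq))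
  unique⇒inj (x ∷ w) (x∉ ∷ u) (suc x') (suc y) (s≤s x<) (s≤s y<) eq = cong suc (unique⇒inj w u x' y x< y< eq)

  inj⇒unique : ∀ w → Inj w → Unique w
  inj⇒unique [] _ = []
  inj⇒unique (x ∷ w) inj = All.tabulate head-fresh ∷ inj⇒unique w tail-inj
    where
    tail-inj : Inj w
    tail-inj a b a< b< eq = suc-injective (inj (suc a) (suc b) (s<s a<) (s<s b<) eq)
    head-fresh : ∀ {y} → y ∈ w → x ≢ y
    head-fresh y∈ x≡y with ∈⇒ix 0 w y∈
    ... | i , i< , eq with inj 0 (suc i) z<s (s<s i<) (Eq.trans x≡y (sym eq))
    ... | ()

  at-drop : ∀ k (w : List ℕ) t → at (drop k w) t ≡ at w (k + t)
  at-drop zero w t = refl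
  at-drop (suc k) [] t = refl
  at-drop (suc k) (x ∷ w) t = at-drop k w t

  at-take : ∀ m (w : List ℕ) t → t < m → at (take m w) t ≡ at w t
  at-take (suc m) [] t _ = refl
  at-take (suc m) (x ∷ w) zero _ = refl
  at-take (suc m) (x ∷ w) (suc t) (s≤s t<) = at-take m w t t<

  at-++ˡ : ∀ (xs ys : List ℕ) i → i < length xs → at (xs ++ ys) i ≡ at xs i
  at-++ˡ (x ∷ xs) ys zero _ = refl
  at-++ˡ (x ∷ xs) ys (suc i) (s≤s i<) = at-++ˡ xs ys i i<

  at-++ʳ : ∀ (xs ys : List ℕ) i → at (xs ++ ys) (length xs + i) ≡ at ys i
  at-++ʳ [] ys i = refl
  at-++ʳ (x ∷ xs) ys i = at-++ʳ xs ys i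

  at-map : ∀ o (xs : List ℕ) t → t < length xs → at (map (o +_) xs) t ≡ o + at xs t
  at-map o (x ∷ xs) zero _ = refl
  at-map o (x ∷ xs) (suc t) (s≤s t<) = at-map o xs t t<

  at-concat : ∀ (ws : List (List ℕ)) j t → j < length ws → t < length (ix [] ws j)
            → at (concat ws) (sum (take j (map length ws)) + t) ≡ at (ix [] ws j) t
  at-concat (w ∷ ws) zero t _ t< = at-++ˡ w (concat ws) t t<
  at-concat (w ∷ ws) (suc j) t (s≤s j<) t< =
    Eq.trans (cong (at (w ++ concat ws)) (+-assoc (length w) (sum (take j (map length ws))) t))
      (Eq.trans (at-++ʳ w (concat ws) _) (at-concat ws j t j< t<))

  ix-zipWith : ∀ {A B C : Set} (dA : A) (dB : B) (dC : C) (f : A → B → C) xs ys j → j < length xs → j < length ys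
             → ix dC (zipWith f xs ys) j ≡ f (ix dA xs j) (ix dB ys j)
  ix-zipWith dA dB dC f (x ∷ xs) (y ∷ ys) zero _ _ = refl
  ix-zipWith dA dB dC f (x ∷ xs) (y ∷ ys) (suc j) (s≤s j<xs) (s≤s j<ys) = ix-zipWith dA dB dC f xs ys j j<xs j<ys

  ix-map-length : ∀ (ws : List (List ℕ)) j → ix 0 (map length ws) j ≡ length (ix [] ws j)
  ix-map-length [] j = refl
  ix-map-length (w ∷ ws) zero = refl
  ix-map-length (w ∷ ws) (suc j) = ix-map-length ws j

  pigeonhole : ∀ M L c (g : ℕ → ℕ) → (∀ t t' → t < M → t' < M → g t ≡ g t' → t ≡ t')
             → (∀ t → t < M → c ≤ g t × g t < c + L) → M ≤ L
  pigeonhole M L c g inj range with M ≤? L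
  ... | yes M≤L = M≤L
  ... | no M≰L with Fin.pigeonhole (≰⇒> M≰L) shifted
    where
    shifted< : ∀ t → t < M → g t ∸ c < L
    shifted< t t< = +-cancelˡ-< c (g t ∸ c) L
      (Eq.subst (_< c + L) (sym (m+[n∸m]≡n (proj₁ (range t t<)))) (proj₂ (range t t<)))
    shifted : Fin M → Fin L
    shifted i = fromℕ< (shifted< (toℕ i) (Fin.toℕ<n i))
  ... | i , j , i<j , eq = ⊥-elim (<⇒≢ i<j (inj (toℕ i) (toℕ j) (Fin.toℕ<n i) (Fin.toℕ<n j) gi≡gj))
    where
    gi≡gj : g (toℕ i) ≡ g (toℕ j)
    gi≡gj = ∸-cancelʳ-≡ (proj₁ (range (toℕ i) (Fin.toℕ<n i))) (proj₁ (range (toℕ j) (Fin.toℕ<n j)))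
              (Eq.trans (sym (Fin.toℕ-fromℕ< _)) (Eq.trans (cong toℕ eq) (Fin.toℕ-fromℕ< _)))

-- A permutation is the same as a duplicate-free list whose values lie
-- below its length; the second form is the one positional arguments use.
module Permutations where
  open Positions

  Good : List ℕ → Set
  Good w = Unique w × All (_< length w) w

  isPerm⇒good : ∀ w → IsPerm w → Good w
  isPerm⇒good w w↭ = PermSetoid.Unique-resp-↭ (setoid ℕ) (↭⇒↭ₛ (↭-sym w↭)) (upTo⁺ (length w))
                   , All.tabulate (λ x∈ → ∈-upTo⁻ (∈-resp-↭ w↭ x∈))

  covers : ∀ w → Inj w → All (_< length w) w → ∀ v → v < length w → v ∈ w
  covers w inj bounded v v< with v ∈? w
  ... | yes v∈ = v∈
  ... | no v∉ = ⊥-elim (1+n≰n (pigeonhole (suc (length w)) (length w) 0 g g-inj g-range))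
    where
    g : ℕ → ℕ
    g zero = v
    g (suc t) = at w t
    g-inj : ∀ t t' → t < suc (length w) → t' < suc (length w) → g t ≡ g t' → t ≡ t'
    g-inj zero zero _ _ _ = refl
    g-inj zero (suc t') _ (s≤s t'<) e = ⊥-elim (v∉ (Eq.subst (_∈ w) (sym e) (ix⇒∈ 0 w t' t'<)))
    g-inj (suc t) zero (s≤s t<) _ e = ⊥-elim (v∉ (Eq.subst (_∈ w) e (ix⇒∈ 0 w t t<)))
    g-inj (suc t) (suc t') (s≤s t<) (s≤s t'<) e = cong suc (inj t t' t< t'< e)
    g-range : ∀ t → t < suc (length w) → 0 ≤ g t × g t < 0 + length w
    g-range zero _ = z≤n , v<
    g-range (suc t) (s≤s t<) = z≤n , All⇒ix 0 w bounded t t<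

  good⇒isPerm : ∀ w → Good w → IsPerm w
  good⇒isPerm w (uniq , bounded) = ∼bag⇒↭ (unique∧set⇒bag uniq (upTo⁺ (length w)) (mk⇔ to-range from-range))
    where
    to-range : ∀ {x} → x ∈ w → x ∈ upTo (length w)
    to-range x∈ = ∈-upTo⁺ (All.lookup bounded x∈)
    from-range : ∀ {x} → x ∈ upTo (length w) → x ∈ w
    from-range {x} x∈ = covers w (unique⇒inj w uniq) bounded x (∈-upTo⁻ x∈)

module Intervals where
  open Positions

  InWindow : ℕ → ℕ → ℕ → Set
  InWindow p len x = p ≤ x × x < p + len

  OutsideWindow : ℕ → ℕ → ℕ → Set
  OutsideWindow p len x = x < p ⊎ p + len ≤ x

  window? : ∀ p len x → InWindow p len x ⊎ OutsideWindow p len x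
  window? p len x with p ≤? x | x <? p + len
  ... | no p≰x | _ = inj₂ (inj₁ (≰⇒> p≰x))
  ... | yes _ | no x≮end = inj₂ (inj₂ (≮⇒≥ x≮end))
  ... | yes p≤x | yes x<end = inj₁ (p≤x , x<end)

  in-and-out : ∀ {p len x} → InWindow p len x → OutsideWindow p len x → ⊥
  in-and-out (p≤x , _) (inj₁ x<p) = <⇒≱ x<p p≤x
  in-and-out (_ , x<end) (inj₂ end≤x) = <⇒≱ x<end end≤x

  record Interval (σ : List ℕ) (p len c : ℕ) : Set where
    constructor interval
    field
      fits : p + len ≤ length σ
      values : ∀ t → t < len → c ≤ at σ (p + t) × at σ (p + t) < c + len

  window-value : ∀ {σ p len c x} → Interval σ p len c → InWindow p len x → c ≤ at σ x × at σ x < c + len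
  window-value {σ} {p} {len} {c} {x} (interval _ values) (p≤x , x<) =
    Eq.subst (λ y → c ≤ at σ y × at σ y < c + len) (m+[n∸m]≡n p≤x) (values (x ∸ p) offset<)
    where
    offset< : x ∸ p < len
    offset< = +-cancelˡ-< p (x ∸ p) len (Eq.subst (_< p + len) (sym (m+[n∸m]≡n p≤x)) x<)

  -- In an injective σ, no position outside an interval holds one of its
  -- values: otherwise len + 1 distinct values would fit in a range of size len.
  interval-owns-its-values : ∀ {σ p len c} → Inj σ → Interval σ p len c → ∀ x → x < length σ
                           → OutsideWindow p len x → c ≤ at σ x → at σ x < c + len → ⊥
  interval-owns-its-values {σ} {p} {len} {c} inj (interval fits values) x x< outside lo hi =
    1+n≰n (pigeonhole (suc len) len c (λ t → at σ (pos t)) value-inj value-range)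
    where
    pos : ℕ → ℕ
    pos zero = x
    pos (suc t) = p + t
    pos< : ∀ t → t < suc len → pos t < length σ
    pos< zero _ = x<
    pos< (suc t) (s≤s t<) = <-≤-trans (+-monoʳ-< p t<) fits
    x-off-window : ∀ t → t < len → x ≢ p + t
    x-off-window t t< x≡ = in-and-out (Eq.subst (p ≤_) (sym x≡) (m≤m+n p t) , Eq.subst (_< p + len) (sym x≡) (+-monoʳ-< p t<)) outside
    pos-inj : ∀ t t' → t < suc len → t' < suc len → pos t ≡ pos t' → t ≡ t'
    pos-inj zero zero _ _ _ = refl
    pos-inj zero (suc t') _ (s≤s t'<) e = ⊥-elim (x-off-window t' t'< e)
    pos-inj (suc t) zero (s≤s t<) _ e = ⊥-elim (x-off-window t t< (sym e))
    pos-inj (suc t) (suc t') _ _ e = cong suc (+-cancelˡ-≡ p t t' e)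
    value-inj : ∀ t t' → t < suc len → t' < suc len → at σ (pos t) ≡ at σ (pos t') → t ≡ t'
    value-inj t t' t< t'< e = pos-inj t t' t< t'< (inj (pos t) (pos t') (pos< t t<) (pos< t' t'<) e)
    value-range : ∀ t → t < suc len → c ≤ at σ (pos t) × at σ (pos t) < c + len
    value-range zero _ = lo , hi
    value-range (suc t) (s≤s t<) = values t t<

module ContiguityCriterion where
  open Positions
  open Permutations
  open Intervals

  position-of : List ℕ → ℕ → ℕ
  position-of [] v = 0
  position-of (x ∷ xs) v with x ≟ v
  ... | yes _ = 0
  ... | no _ = suc (position-of xs v)

  position-of-correct : ∀ w v → v ∈ w → position-of w v < length w × at w (position-of w v) ≡ v
  position-of-correct (x ∷ xs) v v∈ with x ≟ v
  ... | yes x≡v = z<s , x≡v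
  position-of-correct (x ∷ xs) v (here refl) | no x≢v = ⊥-elim (x≢v refl)
  position-of-correct (x ∷ xs) v (there v∈) | no _ =
    let (q< , q≡) = position-of-correct xs v v∈ in s<s q< , q≡

  length-window : ∀ k m (w : List ℕ) → k + m ≤ length w → length (take m (drop k w)) ≡ m
  length-window k m w fits rewrite List.length-take m (drop k w) | List.length-drop k w =
    m≤n⇒m⊓n≡m (Eq.subst (_≤ length w ∸ k) (m+n∸m≡n k m) (∸-monoˡ-≤ k fits))

  window-minimum : (w : List ℕ) → ∀ k m' → ∃ λ a → InWindow k (suc m') a × (∀ j → InWindow k (suc m') j → at w a ≤ at w j)
  window-minimum w k zero = k , (≤-refl , m<m+n k z<s) , λ j (k≤j , j<) → ≤-reflexive (cong (at w) (≤-antisym k≤j (≤-pred (Eq.subst (j <_) (+-comm k 1) j<))))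
  window-minimum w k (suc m') with window-minimum w k m'
  ... | a , (k≤a , a<) , a-min with at w a ≤? at w (k + suc m')
  ...   | yes a≤new = a , (k≤a , <-trans a< (+-monoʳ-< k ≤-refl)) , minimal
    where
    minimal : ∀ j → InWindow k (suc (suc m')) j → at w a ≤ at w j
    minimal j (k≤j , j<) with m≤n⇒m<n∨m≡n (≤-pred (Eq.subst (j <_) (+-suc k (suc m')) j<))
    ... | inj₁ j<new = a-min j (k≤j , j<new)
    ... | inj₂ refl = a≤new
  ...   | no a≰new = k + suc m' , (m≤m+n k (suc m') , +-monoʳ-< k ≤-refl) , minimal
    where
    minimal : ∀ j → InWindow k (suc (suc m')) j → at w (k + suc m') ≤ at w j
    minimal j (k≤j , j<) with m≤n⇒m<n∨m≡n (≤-pred (Eq.subst (j <_) (+-suc k (suc m')) j<))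
    ... | inj₁ j<new = ≤-trans (<⇒≤ (≰⇒> a≰new)) (a-min j (k≤j , j<new))
    ... | inj₂ refl = ≤-refl

  module _ (π : List ℕ) (inj : Inj π) (bounded : All (_< length π) π) (k m' : ℕ) (fits : k + suc m' ≤ length π)
           (no-gap : ∀ a b j → InWindow k (suc m') a → InWindow k (suc m') b → j < length π → OutsideWindow k (suc m') j
                   → at π a < at π j → at π j < at π b → ⊥) where

    private
      n = length π
      a = proj₁ (window-minimum π k m')
      a-in = proj₁ (proj₂ (window-minimum π k m'))
      a-min = proj₂ (proj₂ (window-minimum π k m'))

    in-π : ∀ j → InWindow k (suc m') j → j < n
    in-π j (_ , j<) = <-≤-trans j< fits

    outside-not-between : ∀ q j → q < n → OutsideWindow k (suc m') q → InWindow k (suc m') j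
                        → at π a ≤ at π q → at π q ≤ at π j → ⊥
    outside-not-between q j q< q-out j-in a≤q q≤j with m≤n⇒m<n∨m≡n a≤q | m≤n⇒m<n∨m≡n q≤j
    ... | inj₂ a≡q | _ = in-and-out (Eq.subst (InWindow k (suc m')) (inj a q (in-π a a-in) q< a≡q) a-in) q-out
    ... | inj₁ _ | inj₂ q≡j = in-and-out (Eq.subst (InWindow k (suc m')) (sym (inj q j q< (in-π j j-in) q≡j)) j-in) q-out
    ... | inj₁ a<q | inj₁ q<j = no-gap a j q a-in j-in q< q-out a<q q<j

    value-held-inside : ∀ v j → InWindow k (suc m') j → at π a ≤ v → v ≤ at π j → InWindow k (suc m') (position-of π v)
    value-held-inside v j j-in a≤v v≤j with position-of-correct π v (covers π inj bounded v (≤-<-trans v≤j (All⇒ix 0 π bounded j (in-π j j-in))))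
    ... | q< , q≡ with window? k (suc m') (position-of π v)
    ...   | inj₁ q-in = q-in
    ...   | inj₂ q-out = ⊥-elim (outside-not-between (position-of π v) j q< q-out j-in
                                   (Eq.subst (at π a ≤_) (sym q≡) a≤v) (Eq.subst (_≤ at π j) (sym q≡) v≤j))

    window-values-below : ∀ j → InWindow k (suc m') j → at π j < at π a + suc m'
    window-values-below j j-in with at π j <? at π a + suc m'
    ... | yes below = below
    ... | no not-below = ⊥-elim (1+n≰n (pigeonhole (suc (suc m')) (suc m') k g g-inj g-range))
      where
      g : ℕ → ℕ
      g t = position-of π (at π a + t)
      reaches-j : ∀ t → t < suc (suc m') → at π a + t ≤ at π j
      reaches-j t t< = ≤-trans (+-monoʳ-≤ (at π a) (≤-pred t<)) (≮⇒≥ not-below)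
      g-correct : ∀ t → t < suc (suc m') → g t < n × at π (g t) ≡ at π a + t
      g-correct t t< = position-of-correct π _
        (covers π inj bounded _ (≤-<-trans (reaches-j t t<) (All⇒ix 0 π bounded j (in-π j j-in))))
      g-inj : ∀ t t' → t < suc (suc m') → t' < suc (suc m') → g t ≡ g t' → t ≡ t'
      g-inj t t' t< t'< e = +-cancelˡ-≡ (at π a) t t'
        (Eq.trans (sym (proj₂ (g-correct t t<))) (Eq.trans (cong (at π) e) (proj₂ (g-correct t' t'<))))
      g-range : ∀ t → t < suc (suc m') → k ≤ g t × g t < k + suc m'
      g-range t t< = value-held-inside (at π a + t) j j-in (m≤m+n _ t) (reaches-j t t<)

    contiguity-criterion : Contiguous (take (suc m') (drop k π))
    contiguity-criterion = at π a , ix⇒All 0 (take (suc m') (drop k π)) in-range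
      where
      in-range : ∀ t → t < length (take (suc m') (drop k π))
               → at π a ≤ at (take (suc m') (drop k π)) t × at (take (suc m') (drop k π)) t < at π a + length (take (suc m') (drop k π))
      in-range t t< rewrite length-window k (suc m') π fits | at-take (suc m') (drop k π) t t< | at-drop k π t =
        a-min (k + t) (m≤m+n k t , +-monoʳ-< k t<) , window-values-below (k + t) (m≤m+n k t , +-monoʳ-< k t<)

-- A block structure of σ over π: σ is cut into n = |π| consecutive
-- nonempty blocks, block j starting at position P j, of length L j, with
-- values in [O j, O j + L j), and the value ranges of the blocks are
-- ordered as the entries of π.  Every inflation π[α₁,…,αₙ] carries one.
module BlockStructure where
  open Positions
  open Intervals
  open ContiguityCriterion using (contiguity-criterion)

  record Blocks (σ π : List ℕ) : Set where
    field
      L P O : ℕ → ℕ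
      nonempty : ∀ j → j < length π → 1 ≤ L j
      start-zero : P 0 ≡ 0
      start-suc : ∀ j → j < length π → P (suc j) ≡ P j + L j
      start-end : P (length π) ≡ length σ
      block-values : ∀ j t → j < length π → t < L j → O j ≤ at σ (P j + t) × at σ (P j + t) < O j + L j
      ordered : ∀ a j → a < length π → j < length π → at π a < at π j → O a + L a ≤ O j

  module BlockLemmas {σ π : List ℕ} (S : Blocks σ π) where
    open Blocks S

    n N : ℕ
    n = length π
    N = length σ

    InBlock : ℕ → ℕ → Set
    InBlock x j = InWindow (P j) (L j) x

    start-increasing : ∀ j → j < n → P j < P (suc j)
    start-increasing j j< = Eq.subst (P j <_) (sym (start-suc j j<))
      (Eq.subst (_≤ P j + L j) (+-comm (P j) 1) (+-monoʳ-≤ (P j) (nonempty j j<)))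

    start-monotone : ∀ j k → j ≤ k → k ≤ n → P j ≤ P k
    start-monotone j zero z≤n _ = ≤-refl
    start-monotone j (suc k) j≤ k< with m≤n⇒m<n∨m≡n j≤
    ... | inj₂ refl = ≤-refl
    ... | inj₁ (s≤s j≤k) = ≤-trans (start-monotone j k j≤k (<⇒≤ k<)) (<⇒≤ (start-increasing k k<))

    start-bounded : ∀ j → j ≤ n → P j ≤ N
    start-bounded j j≤ = Eq.subst (P j ≤_) start-end (start-monotone j n j≤ ≤-refl)

    block-end : ∀ j → j < n → P j + L j ≤ N
    block-end j j< = Eq.subst (_≤ N) (start-suc j j<) (start-bounded (suc j) j<)

    block-interval : ∀ j → j < n → Interval σ (P j) (L j) (O j)
    block-interval j j< = interval (block-end j j<) λ t t< → block-values j t j< t<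

    start-in-block : ∀ j → j < n → InBlock (P j) j
    start-in-block j j< = ≤-refl , m<m+n (P j) (nonempty j j<)

    value-in-block : ∀ x j → j < n → InBlock x j → O j ≤ at σ x × at σ x < O j + L j
    value-in-block x j j< = window-value (block-interval j j<)

    start-value : ∀ j → j < n → O j ≤ at σ (P j) × at σ (P j) < O j + L j
    start-value j j< = value-in-block (P j) j j< (start-in-block j j<)

    blocks-separate-values : Inj π → ∀ x y j j' → j < n → j' < n → InBlock x j → InBlock y j' → j ≢ j' → at σ x ≢ at σ y
    blocks-separate-values injπ x y j j' j< j'< x-in y-in j≢j' same with <-cmp (at π j) (at π j')
    ... | tri≈ _ πj≡πj' _ = j≢j' (injπ j j' j< j'< πj≡πj')
    ... | tri< below _ _ = <⇒≱ (proj₂ (value-in-block x j j< x-in))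
        (≤-trans (ordered j j' j< j'< below) (Eq.subst (O j' ≤_) (sym same) (proj₁ (value-in-block y j' j'< y-in))))
    ... | tri> _ _ above = <⇒≱ (proj₂ (value-in-block y j' j'< y-in))
        (≤-trans (ordered j' j j'< j< above) (Eq.subst (O j ≤_) same (proj₁ (value-in-block x j j< x-in))))

    find-block : ∀ x → x < N → ∃ λ j → j < n × InBlock x j
    find-block x x< = search n ≤-refl (Eq.subst (x <_) (sym start-end) x<)
      where
      search : ∀ k → k ≤ n → x < P k → ∃ λ j → j < k × InBlock x j
      search zero _ x<P0 = ⊥-elim (n≮0 (Eq.subst (x <_) start-zero x<P0))
      search (suc k) k< x<Pk+1 with x <? P k
      ... | yes x<Pk = let (j , j< , in-j) = search k (<⇒≤ k<) x<Pk in j , m<n⇒m<1+n j< , in-j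
      ... | no x≮Pk = k , ≤-refl , ≮⇒≥ x≮Pk , Eq.subst (x <_) (start-suc k k<) x<Pk+1

    -- If blocks a and b start inside an interval of σ and π a < π j < π b,
    -- then block j starts inside it too: its values lie between theirs.
    starts-not-separated : ∀ {p len c} → Inj σ → Interval σ p len c → ∀ a b j → a < n → b < n → j < n
      → InWindow p len (P a) → InWindow p len (P b) → OutsideWindow p len (P j)
      → at π a < at π j → at π j < at π b → ⊥
    starts-not-separated {p} {len} {c} inj I a b j a< b< j< a-in b-in j-out πa<πj πj<πb =
      interval-owns-its-values inj I (P j) (<-≤-trans (start-increasing j j<) (start-bounded (suc j) j<)) j-out
        (≤-trans (proj₁ (window-value I a-in))
          (<⇒≤ (<-≤-trans (proj₂ (start-value a a<)) (≤-trans (ordered a j a< j< πa<πj) (proj₁ (start-value j j<))))))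
        (<-≤-trans (proj₂ (start-value j j<))
          (≤-trans (ordered j b j< b< πj<πb) (≤-trans (proj₁ (start-value b b<)) (<⇒≤ (proj₂ (window-value I b-in))))))

    window-lemma : ∀ {p len c} → Inj σ → Inj π → All (_< n) π → Interval σ p len c → ∀ k m' → k + suc m' ≤ n
      → (∀ j → InWindow k (suc m') j → InWindow p len (P j))
      → (∀ j → j < n → OutsideWindow k (suc m') j → OutsideWindow p len (P j))
      → Contiguous (take (suc m') (drop k π))
    window-lemma injσ injπ bounded I k m' fits inside outside =
      contiguity-criterion π injπ bounded k m' fits λ a b j a-in b-in j< j-out →
        starts-not-separated injσ I a b j (in-π a-in) (in-π b-in) j< (inside a a-in) (inside b b-in) (outside j j< j-out)
      where
      in-π : ∀ {j} → InWindow k (suc m') j → j < n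
      in-π (_ , j<) = <-≤-trans j< fits

-- Over a simple permutation, block structures are rigid: two block
-- structures of the same σ have the same block lengths.  At the first
-- block where they disagree, the longer block would be an interval of σ
-- containing the starts of several consecutive shorter blocks, and these
-- would form a proper interval of π.
module Rigidity where
  open Positions
  open Permutations
  open Intervals
  open BlockStructure
  open Blocks

  simple-window-is-whole : ∀ {π} → Simple π → ∀ k m' → 1 ≤ m' → k + suc m' ≤ length π
                         → Contiguous (take (suc m') (drop k π)) → k ≡ 0 × suc m' ≡ length π
  simple-window-is-whole {π} (_ , _ , no-interval) k m' m'≥1 fits contiguous with suc m' <? length π
  ... | yes proper = ⊥-elim (no-interval k (suc m') (s≤s m'≥1) proper fits contiguous)
  ... | no whole = n≤0⇒n≡0 (+-cancelʳ-≤ (suc m') k 0 (≤-trans fits (≮⇒≥ whole)))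
                 , ≤-antisym (≤-trans (m≤n+m (suc m') k) fits) (≮⇒≥ whole)

  module _ {σ π : List ℕ} (injσ : Inj σ) (π-simple : Simple π) where
    private
      n N : ℕ
      n = length π
      N = length σ
      injπ : Inj π
      injπ = unique⇒inj π (proj₁ (isPerm⇒good π (proj₁ π-simple)))
      boundedπ : All (_< n) π
      boundedπ = proj₂ (isPerm⇒good π (proj₁ π-simple))

    module _ (S T : Blocks σ π) where
      private
        module A = Blocks S
        module B = Blocks T
        module LA = BlockLemmas S
        module LB = BlockLemmas T

      -- T's blocks 1, …, n-1 cannot all start inside S's last block
      last-block-too-early : ∀ k → suc k ≡ n → A.P k < B.P 1 → ⊥
      last-block-too-early k k+1≡n Pk<B1 =
        1≢0 (proj₁ (simple-window-is-whole π-simple 1 r r≥1 (≤-reflexive (sym n≡))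
                     (LB.window-lemma injσ injπ boundedπ (LA.block-interval k k<) 1 r (≤-reflexive (sym n≡)) inside outside)))
        where
        1≢0 : 1 ≢ 0
        1≢0 ()
        r : ℕ
        r = n ∸ 2
        n≡ : n ≡ suc (suc r)
        n≡ = sym (m+[n∸m]≡n {2} {n} (≤-trans (s≤s (s≤s z≤n)) (proj₁ (proj₂ π-simple))))
        r≥1 : 1 ≤ r
        r≥1 = ≤-pred (≤-pred (Eq.subst (3 ≤_) n≡ (≤-trans (n≤1+n 3) (proj₁ (proj₂ π-simple)))))
        k< : k < n
        k< = Eq.subst (k <_) k+1≡n ≤-refl
        last-block-ends : A.P k + A.L k ≡ N
        last-block-ends = Eq.trans (sym (A.start-suc k k<)) (Eq.trans (cong A.P k+1≡n) A.start-end)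
        inside : ∀ j → InWindow 1 (suc r) j → InWindow (A.P k) (A.L k) (B.P j)
        inside j (1≤j , j<) = <⇒≤ (<-≤-trans Pk<B1 (LB.start-monotone 1 j 1≤j (<⇒≤ j<n)))
                            , Eq.subst (B.P j <_) (sym last-block-ends) (<-≤-trans (LB.start-increasing j j<n) (LB.start-bounded (suc j) j<n))
          where
          j<n : j < n
          j<n = Eq.subst (j <_) (sym n≡) j<
        outside : ∀ j → j < n → OutsideWindow 1 (suc r) j → OutsideWindow (A.P k) (A.L k) (B.P j)
        outside zero _ _ = inj₁ (Eq.subst (_< A.P k) (sym B.start-zero)
          (<-≤-trans (Eq.subst (_< A.P 1) A.start-zero (LA.start-increasing 0 (≤-<-trans z≤n k<)))
                     (LA.start-monotone 1 k (Eq.subst (1 ≤_) (sym k≡) (s≤s z≤n)) (<⇒≤ k<))))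
          where
          k≡ : k ≡ suc r
          k≡ = suc-injective (Eq.trans k+1≡n n≡)
        outside (suc j) _ (inj₁ (s≤s ()))
        outside (suc j) j< (inj₂ n≤) = ⊥-elim (<⇒≱ j< (Eq.subst (_≤ suc j) (sym n≡) n≤))

      no-longer-block : ∀ i → i < n → A.P i ≡ B.P i → A.L i < B.L i → ⊥
      no-longer-block i i< same-start shorter with B.L i in L≡ | shorter
      ... | suc len' | s≤s short≤ = spill (LA.find-block last last<N)
        where
        p last : ℕ
        p = A.P i
        last = p + len'
        W : Interval σ p (suc len') (B.O i)
        W = Eq.subst₂ (λ q ℓ → Interval σ q ℓ (B.O i)) (sym same-start) L≡ (LB.block-interval i i<)
        last<N : last < N
        last<N = <-≤-trans (+-monoʳ-< p ≤-refl) (Interval.fits W)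
        -- the S-block k holding the last position of W starts inside W
        spill : (∃ λ k → k < n × LA.InBlock last k) → ⊥
        spill (k , k< , Pk≤last , last<end) =
          last-block-too-early k k+1≡n (≤-<-trans Pk≤last (Eq.subst (last <_) W-ends-at-B1 (+-monoʳ-< p ≤-refl)))
          where
          i<k : i < k
          i<k with i <? k
          ... | yes i<k = i<k
          ... | no i≮k = ⊥-elim (<⇒≱ last<end (begin
                  A.P k + A.L k  ≡⟨ A.start-suc k k< ⟨
                  A.P (suc k)    ≤⟨ LA.start-monotone (suc k) (suc i) (s≤s (≮⇒≥ i≮k)) i< ⟩
                  A.P (suc i)    ≡⟨ A.start-suc i i< ⟩
                  p + A.L i      ≤⟨ +-monoʳ-≤ p short≤ ⟩
                  last           ∎))
            where open ≤-Reasoning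
          m' : ℕ
          m' = k ∸ i
          end≡ : i + suc m' ≡ suc k
          end≡ = Eq.trans (+-suc i m') (cong suc (m+[n∸m]≡n (<⇒≤ i<k)))
          fits : i + suc m' ≤ n
          fits = Eq.subst (_≤ n) (sym end≡) k<
          inside : ∀ j → InWindow i (suc m') j → InWindow p (suc len') (A.P j)
          inside j (i≤j , j<end) = LA.start-monotone i j i≤j (<⇒≤ j<n)
                                 , ≤-<-trans (LA.start-monotone j k j≤k (<⇒≤ k<)) (≤-<-trans Pk≤last (+-monoʳ-< p ≤-refl))
            where
            j≤k : j ≤ k
            j≤k = ≤-pred (Eq.subst (j <_) end≡ j<end)
            j<n : j < n
            j<n = ≤-<-trans j≤k k<
          outside : ∀ j → j < n → OutsideWindow i (suc m') j → OutsideWindow p (suc len') (A.P j)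
          outside j j<n (inj₁ j<i) = inj₁ (<-≤-trans (LA.start-increasing j j<n) (LA.start-monotone (suc j) i j<i (<⇒≤ i<)))
          outside j j<n (inj₂ end≤j) = inj₂ (begin
            p + suc len'   ≡⟨ +-suc p len' ⟩
            suc last       ≤⟨ last<end ⟩
            A.P k + A.L k  ≡⟨ A.start-suc k k< ⟨
            A.P (suc k)    ≤⟨ LA.start-monotone (suc k) j (Eq.subst (_≤ j) end≡ end≤j) (<⇒≤ j<n) ⟩
            A.P j          ∎)
            where open ≤-Reasoning
          whole : i ≡ 0 × suc m' ≡ n
          whole = simple-window-is-whole π-simple i m' (m<n⇒0<n∸m i<k) fits
                    (LA.window-lemma injσ injπ boundedπ W i m' fits inside outside)
          k+1≡n : suc k ≡ n
          k+1≡n = Eq.trans (sym end≡) (Eq.trans (cong (_+ suc m') (proj₁ whole)) (proj₂ whole))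
          W-ends-at-B1 : p + suc len' ≡ B.P 1
          W-ends-at-B1 = begin
            p + suc len'   ≡⟨ cong₂ _+_ same-start (sym L≡) ⟩
            B.P i + B.L i  ≡⟨ B.start-suc i i< ⟨
            B.P (suc i)    ≡⟨ cong (λ q → B.P (suc q)) (proj₁ whole) ⟩
            B.P 1          ∎
            where open Eq.≡-Reasoning

    lengths-agree-at : (S T : Blocks σ π) → ∀ i → i < n → P S i ≡ P T i → L S i ≡ L T i
    lengths-agree-at S T i i< same-start with <-cmp (L S i) (L T i)
    ... | tri< shorter _ _ = ⊥-elim (no-longer-block S T i i< same-start shorter)
    ... | tri≈ _ same _ = same
    ... | tri> _ _ longer = ⊥-elim (no-longer-block T S i i< (sym same-start) longer)

    starts-agree : (S T : Blocks σ π) → ∀ i → i ≤ n → P S i ≡ P T i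
    starts-agree S T zero _ = Eq.trans (start-zero S) (sym (start-zero T))
    starts-agree S T (suc i) i< = begin
      P S (suc i)    ≡⟨ start-suc S i i< ⟩
      P S i + L S i  ≡⟨ cong₂ _+_ same-start (lengths-agree-at S T i i< same-start) ⟩
      P T i + L T i  ≡⟨ start-suc T i i< ⟨
      P T (suc i)    ∎
      where
      open Eq.≡-Reasoning
      same-start : P S i ≡ P T i
      same-start = starts-agree S T i (<⇒≤ i<)

    lengths-agree : (S T : Blocks σ π) → ∀ j → j < n → L S j ≡ L T j
    lengths-agree S T j j< = lengths-agree-at S T j j< (starts-agree S T j (<⇒≤ j<))

-- The inflation σ = π[α₁,…,αₙ] carries a block structure over π: block j
-- is αⱼ shifted up by  offset π αs (π j), the total length of the blocks
-- whose π-value is smaller.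
module Inflation where
  open Positions
  open Permutations
  open BlockStructure

  lengths-of-shifted : ∀ (g : ℕ → ℕ → ℕ) (xs : List ℕ) (ws : List (List ℕ)) → length xs ≡ length ws
                     → map length (zipWith (λ s w → map (g s) w) xs ws) ≡ map length ws
  lengths-of-shifted g [] [] _ = refl
  lengths-of-shifted g (x ∷ xs) (w ∷ ws) e = cong₂ _∷_ (List.length-map (g x) w) (lengths-of-shifted g xs ws (suc-injective e))

  sum-take-suc : ∀ (xs : List ℕ) j → j < length xs → sum (take (suc j) xs) ≡ sum (take j xs) + ix 0 xs j
  sum-take-suc (x ∷ xs) zero _ = +-comm x 0
  sum-take-suc (x ∷ xs) (suc j) (s≤s j<) = Eq.trans (cong (x +_) (sum-take-suc xs j j<)) (sym (+-assoc x _ _))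

  length-concat : ∀ (ws : List (List ℕ)) → length (concat ws) ≡ sum (map length ws)
  length-concat [] = refl
  length-concat (w ∷ ws) = Eq.trans (List.length-++ w) (cong (length w +_) (length-concat ws))

  sum-mono : ∀ (f g : ℕ → List ℕ → ℕ) xs ws → (∀ s w → f s w ≤ g s w) → sum (zipWith f xs ws) ≤ sum (zipWith g xs ws)
  sum-mono f g [] ws f≤g = z≤n
  sum-mono f g (x ∷ xs) [] f≤g = z≤n
  sum-mono f g (x ∷ xs) (w ∷ ws) f≤g = +-mono-≤ (f≤g x w) (sum-mono f g xs ws f≤g)

  sum-mono-slack : ∀ (f g : ℕ → List ℕ → ℕ) xs ws a e → a < length xs → a < length ws → (∀ s w → f s w ≤ g s w)
                 → f (ix 0 xs a) (ix [] ws a) + e ≤ g (ix 0 xs a) (ix [] ws a) → sum (zipWith f xs ws) + e ≤ sum (zipWith g xs ws)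
  sum-mono-slack f g (x ∷ xs) (w ∷ ws) zero e _ _ f≤g slack =
    Eq.subst (_≤ g x w + sum (zipWith g xs ws)) (+-comm-middle (f x w) e (sum (zipWith f xs ws)))
      (+-mono-≤ slack (sum-mono f g xs ws f≤g))
    where
    +-comm-middle : ∀ a b c → (a + b) + c ≡ (a + c) + b
    +-comm-middle a b c = Eq.trans (+-assoc a b c) (Eq.trans (cong (a +_) (+-comm b c)) (sym (+-assoc a c b)))
  sum-mono-slack f g (x ∷ xs) (w ∷ ws) (suc a) e (s≤s a<xs) (s≤s a<ws) f≤g slack =
    Eq.subst (_≤ g x w + sum (zipWith g xs ws)) (sym (+-assoc (f x w) _ e))
      (+-mono-≤ (f≤g x w) (sum-mono-slack f g xs ws a e a<xs a<ws f≤g slack))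

  summand : ℕ → ℕ → List ℕ → ℕ
  summand s s' w = if s' <ᵇ s then length w else 0

  n<ᵇn : ∀ n → (n <ᵇ n) ≡ false
  n<ᵇn zero = refl
  n<ᵇn (suc n) = n<ᵇn n

  <⇒<ᵇ≡true : ∀ {m n} → m < n → (m <ᵇ n) ≡ true
  <⇒<ᵇ≡true {zero} {suc n} _ = refl
  <⇒<ᵇ≡true {suc m} {suc n} (s≤s m<n) = <⇒<ᵇ≡true m<n

  summand-monotone : ∀ a b → a < b → ∀ s w → summand a s w ≤ summand b s w
  summand-monotone a b a<b s w with s <ᵇ a in s<a
  ... | false = z≤n
  ... | true rewrite <⇒<ᵇ≡true (<-trans (<ᵇ⇒< s a (Eq.subst T (sym s<a) tt)) a<b) = ≤-refl

  summand-≤-length : ∀ a s w → summand a s w ≤ length w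
  summand-≤-length a s w with s <ᵇ a
  ... | false = z≤n
  ... | true = ≤-refl

  sum-lengths : ∀ (xs : List ℕ) (ws : List (List ℕ)) → length xs ≡ length ws
              → sum (zipWith (λ s w → length w) xs ws) ≡ sum (map length ws)
  sum-lengths [] [] _ = refl
  sum-lengths (x ∷ xs) (w ∷ ws) e = cong (length w +_) (sum-lengths xs ws (suc-injective e))

  module InflationBlocks (π : List ℕ) (αs : List (List ℕ)) (arity≡ : length αs ≡ length π)
                         (nonempty : All (λ α → 1 ≤ length α) αs) where
    n N : ℕ
    n = length π
    N = sum (map length αs)

    σ : List ℕ
    σ = inflate π αs

    shifted : List (List ℕ)
    shifted = zipWith (λ s α → map (offset π αs s +_) α) π αs

    L P O : ℕ → ℕ
    L j = length (ix [] αs j)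
    P j = sum (take j (map length αs))
    O j = offset π αs (at π j)

    j<αs : ∀ {j} → j < n → j < length αs
    j<αs j< = Eq.subst (_ <_) (sym arity≡) j<

    lengths-shifted : map length shifted ≡ map length αs
    lengths-shifted = lengths-of-shifted (λ s → offset π αs s +_) π αs (sym arity≡)

    length-shifted : length shifted ≡ n
    length-shifted = Eq.trans (sym (List.length-map length shifted)) (Eq.trans (cong length lengths-shifted) (Eq.trans (List.length-map length αs) arity≡))

    ix-shifted : ∀ j → j < n → ix [] shifted j ≡ map (O j +_) (ix [] αs j)
    ix-shifted j j< = ix-zipWith 0 [] [] (λ s α → map (offset π αs s +_) α) π αs j j< (j<αs j<)

    length-σ : length σ ≡ N
    length-σ = Eq.trans (length-concat shifted) (cong sum lengths-shifted)

    entry : ∀ j t → j < n → t < L j → at σ (P j + t) ≡ O j + at (ix [] αs j) t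
    entry j t j< t< = begin
      at σ (P j + t)                                   ≡⟨ cong (λ ls → at σ (sum (take j ls) + t)) lengths-shifted ⟨
      at (concat shifted) (sum (take j (map length shifted)) + t)
                                                       ≡⟨ at-concat shifted j t (Eq.subst (j <_) (sym length-shifted) j<) t<shifted ⟩
      at (ix [] shifted j) t                           ≡⟨ cong (λ w → at w t) (ix-shifted j j<) ⟩
      at (map (O j +_) (ix [] αs j)) t                 ≡⟨ at-map (O j) (ix [] αs j) t t< ⟩
      O j + at (ix [] αs j) t                          ∎
      where
      open Eq.≡-Reasoning
      t<shifted : t < length (ix [] shifted j)
      t<shifted = Eq.subst (t <_) (Eq.trans (sym (List.length-map (O j +_) (ix [] αs j))) (cong length (sym (ix-shifted j j<)))) t<

    ordered : ∀ a j → a < n → j < n → at π a < at π j → O a + L a ≤ O j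
    ordered a j a< j< πa<πj =
      sum-mono-slack (summand (at π a)) (summand (at π j)) π αs a (L a) a< (j<αs a<) (summand-monotone _ _ πa<πj) slack
      where
      slack : summand (at π a) (at π a) (ix [] αs a) + L a ≤ summand (at π j) (at π a) (ix [] αs a)
      slack rewrite n<ᵇn (at π a) | <⇒<ᵇ≡true πa<πj = ≤-refl

    top : ∀ j → j < n → O j + L j ≤ N
    top j j< = Eq.subst (O j + L j ≤_) (sum-lengths π αs (sym arity≡))
      (sum-mono-slack (summand (at π j)) (λ s w → length w) π αs j (L j) j< (j<αs j<) (summand-≤-length (at π j)) slack)
      where
      slack : summand (at π j) (at π j) (ix [] αs j) + L j ≤ length (ix [] αs j)
      slack rewrite n<ᵇn (at π j) = ≤-refl

    start-suc : ∀ j → j < n → P (suc j) ≡ P j + L j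
    start-suc j j< = Eq.trans (sum-take-suc (map length αs) j (Eq.subst (j <_) (sym (List.length-map length αs)) (j<αs j<)))
                              (cong (P j +_) (ix-map-length αs j))

    start-end : P n ≡ length σ
    start-end = Eq.trans (cong (λ k → sum (take k (map length αs))) (Eq.trans (sym arity≡) (sym (List.length-map length αs))))
                  (Eq.trans (cong sum (List.take-all _ (map length αs) ≤-refl)) (sym length-σ))

    blocks : All (λ α → All (_< length α) α) αs → Blocks σ π
    blocks bounded = record
      { L = L ; P = P ; O = O
      ; nonempty = λ j j< → All⇒ix [] αs nonempty j (j<αs j<)
      ; start-zero = refl
      ; start-suc = start-suc
      ; start-end = start-end
      ; block-values = λ j t j< t< → Eq.subst (λ v → O j ≤ v × v < O j + L j) (sym (entry j t j< t<))
          (m≤m+n (O j) _ , +-monoʳ-< (O j) (All⇒ix 0 (ix [] αs j) (All⇒ix [] αs bounded j (j<αs j<)) t t<))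
      ; ordered = ordered }

    module _ (πgood : Good π) (αs-good : All Good αs) where
      private
        S : Blocks σ π
        S = blocks (All.map proj₂ αs-good)
        open BlockLemmas S using (InBlock; find-block; value-in-block; blocks-separate-values)

      entry-at : ∀ x j → j < n → InBlock x j → x ∸ P j < L j × at σ x ≡ O j + at (ix [] αs j) (x ∸ P j)
      entry-at x j j< (P≤x , x<) = offset< , Eq.trans (cong (at σ) (sym (m+[n∸m]≡n P≤x))) (entry j (x ∸ P j) j< offset<)
        where
        offset< : x ∸ P j < L j
        offset< = +-cancelˡ-< (P j) (x ∸ P j) (L j) (Eq.subst (_< P j + L j) (sym (m+[n∸m]≡n P≤x)) x<)

      inflation-injective : Inj σ
      inflation-injective x y x< y< same with find-block x x< | find-block y y<
      ... | j , j< , x-in | j' , j'< , y-in with j ≟ j'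
      ...   | no j≢j' = ⊥-elim (blocks-separate-values (unique⇒inj π (proj₁ πgood)) x y j j' j< j'< x-in y-in j≢j' same)
      ...   | yes refl = begin
        x                  ≡⟨ m+[n∸m]≡n (proj₁ x-in) ⟨
        P j + (x ∸ P j)    ≡⟨ cong (P j +_) same-offset ⟩
        P j + (y ∸ P j)    ≡⟨ m+[n∸m]≡n (proj₁ y-in) ⟩
        y                  ∎
        where
        open Eq.≡-Reasoning
        same-offset : x ∸ P j ≡ y ∸ P j
        same-offset = unique⇒inj (ix [] αs j) (proj₁ (All⇒ix [] αs αs-good j (j<αs j<))) (x ∸ P j) (y ∸ P j)
          (proj₁ (entry-at x j j< x-in)) (proj₁ (entry-at y j j< y-in))
          (+-cancelˡ-≡ (O j) _ _ (Eq.trans (sym (proj₂ (entry-at x j j< x-in))) (Eq.trans same (proj₂ (entry-at y j j< y-in)))))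

      inflation-bounded : ∀ x → x < length σ → at σ x < length σ
      inflation-bounded x x< with find-block x x<
      ... | j , j< , x-in = Eq.subst (at σ x <_) (sym length-σ) (<-≤-trans (proj₂ (value-in-block x j j< x-in)) (top j j<))

      inflation-good : Good σ
      inflation-good = inj⇒unique σ inflation-injective , ix⇒All 0 σ inflation-bounded

module SimpleDecomposition where
  open Positions
  open Permutations
  open BlockStructure
  open Inflation

  module _ (C : Perm → Set) (class : IsClass C) where
    mutual
      closure-good : ∀ {w} → Ĉ C w → Good w × 1 ≤ length w
      closure-good (D.base c) = isPerm⇒good _ (proj₁ (proj₁ class _ c)) , proj₂ (proj₁ class _ c)
      closure-good (D.subst {σ} {αs} σ∈ arity≡ αs∈) =
          InflationBlocks.inflation-good σ αs arity≡ α-nonempty (proj₁ σ-good) (All.map proj₁ αs-good)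
        , Eq.subst (1 ≤_) (sym (InflationBlocks.length-σ σ αs arity≡ α-nonempty)) (sum-positive αs α-nonempty αs-nonempty)
        where
        σ-good = closure-good σ∈
        αs-good = closure-good-all αs∈
        α-nonempty = All.map proj₂ αs-good
        αs-nonempty : 1 ≤ length αs
        αs-nonempty = Eq.subst (1 ≤_) (sym arity≡) (proj₂ σ-good)
        sum-positive : ∀ (ws : List (List ℕ)) → All (λ w → 1 ≤ length w) ws → 1 ≤ length ws → 1 ≤ sum (map length ws)
        sum-positive (w ∷ ws) (w≥1 ∷ _) _ = ≤-trans w≥1 (m≤m+n (length w) _)

      closure-good-all : ∀ {ws} → All (Ĉ C) ws → All (λ w → Good w × 1 ≤ length w) ws
      closure-good-all [] = []
      closure-good-all (w∈ ∷ ws∈) = closure-good w∈ ∷ closure-good-all ws∈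

  list-ext : ∀ {A : Set} (d : A) (xs ys : List A) → length xs ≡ length ys → (∀ i → i < length xs → ix d xs i ≡ ix d ys i) → xs ≡ ys
  list-ext d [] [] _ _ = refl
  list-ext d (x ∷ xs) (y ∷ ys) e same = cong₂ _∷_ (same 0 z<s) (list-ext d xs ys (suc-injective e) (λ i i< → same (suc i) (s<s i<)))

  offset-by-lengths : ∀ (π : List ℕ) (αs βs : List (List ℕ)) → map length αs ≡ map length βs → ∀ s → offset π αs s ≡ offset π βs s
  offset-by-lengths π αs βs lengths s = cong sum (summands π αs βs lengths)
    where
    summands : ∀ (π : List ℕ) (αs βs : List (List ℕ)) → map length αs ≡ map length βs
             → zipWith (summand s) π αs ≡ zipWith (summand s) π βs
    summands [] αs βs _ = refl
    summands (x ∷ π) [] [] _ = refl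
    summands (x ∷ π) (α ∷ αs) (β ∷ βs) e = cong₂ _∷_ (same-summand (List.∷-injectiveˡ e)) (summands π αs βs (List.∷-injectiveʳ e))
      where
      same-summand : length α ≡ length β → summand s x α ≡ summand s x β
      same-summand same with x <ᵇ s
      ... | true = same
      ... | false = refl

  same-lengths⇒same-blocks : ∀ π αs βs (α-arity : length αs ≡ length π) (β-arity : length βs ≡ length π)
    (α-nonempty : All (λ α → 1 ≤ length α) αs) (β-nonempty : All (λ β → 1 ≤ length β) βs)
    → (∀ j → j < length π → length (ix [] αs j) ≡ length (ix [] βs j))
    → inflate π αs ≡ inflate π βs → αs ≡ βs
  same-lengths⇒same-blocks π αs βs α-arity β-arity α-nonempty β-nonempty lengths same =
    list-ext [] αs βs (Eq.trans α-arity (sym β-arity)) same-block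
    where
    module IA = InflationBlocks π αs α-arity α-nonempty
    module IB = InflationBlocks π βs β-arity β-nonempty
    length-lists : map length αs ≡ map length βs
    length-lists = list-ext 0 (map length αs) (map length βs)
      (Eq.trans (List.length-map length αs) (Eq.trans α-arity (Eq.trans (sym β-arity) (sym (List.length-map length βs)))))
      (λ i i< → Eq.trans (ix-map-length αs i)
                  (Eq.trans (lengths i (Eq.subst (i <_) (Eq.trans (List.length-map length αs) α-arity) i<)) (sym (ix-map-length βs i))))
    same-block : ∀ j → j < length αs → ix [] αs j ≡ ix [] βs j
    same-block j j<αs = list-ext 0 (ix [] αs j) (ix [] βs j) (lengths j j<) same-entry
      where
      j< : j < length π
      j< = Eq.subst (j <_) α-arity j<αs
      same-entry : ∀ t → t < length (ix [] αs j) → at (ix [] αs j) t ≡ at (ix [] βs j) t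
      same-entry t t< = +-cancelˡ-≡ (IA.O j) _ _ (begin
        IA.O j + at (ix [] αs j) t      ≡⟨ IA.entry j t j< t< ⟨
        at (inflate π αs) (IA.P j + t)  ≡⟨ cong (λ ls → at (inflate π αs) (sum (take j ls) + t)) length-lists ⟩
        at (inflate π αs) (IB.P j + t)  ≡⟨ cong (λ σ → at σ (IB.P j + t)) same ⟩
        at (inflate π βs) (IB.P j + t)  ≡⟨ IB.entry j t j< (Eq.subst (t <_) (lengths j j<) t<) ⟩
        IB.O j + at (ix [] βs j) t      ≡⟨ cong (_+ at (ix [] βs j) t) (offset-by-lengths π αs βs length-lists (at π j)) ⟨
        IA.O j + at (ix [] βs j) t      ∎)
        where open Eq.≡-Reasoning

  lengths-agree-≡ : ∀ {σ σ' π} → Inj σ → Simple π → σ ≡ σ' → (S : Blocks σ π) (T : Blocks σ' π)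
                  → ∀ j → j < length π → Blocks.L S j ≡ Blocks.L T j
  lengths-agree-≡ injσ π-simple refl = Rigidity.lengths-agree injσ π-simple

  all-closure : ∀ {C} k αs → Pointwise (Ĉδ C) (replicate k D.·) αs → All (Ĉ C) αs × length αs ≡ k
  all-closure zero [] [] = [] , refl
  all-closure (suc k) (α ∷ αs) (α∈ ∷ αs∈) = let (αs∈' , arity) = all-closure k αs αs∈ in (α∈ ∷ αs∈') , cong suc arity

  unique-simple : (C : Perm → Set) → IsClass C → ∀ π → Simple π → ∀ αs βs
    → Pointwise (Ĉδ C) (replicate (length π) D.·) αs → Pointwise (Ĉδ C) (replicate (length π) D.·) βs
    → inflate π αs ≡ inflate π βs → αs ≡ βs
  unique-simple C class π π-simple αs βs αs∈ βs∈ same =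
    same-lengths⇒same-blocks π αs βs α-arity β-arity α-nonempty β-nonempty
      (lengths-agree-≡ injσ π-simple same (IA.blocks α-bounded) (IB.blocks β-bounded)) same
    where
    α-all = all-closure (length π) αs αs∈
    β-all = all-closure (length π) βs βs∈
    α-arity = proj₂ α-all
    β-arity = proj₂ β-all
    α-good = closure-good-all C class (proj₁ α-all)
    β-good = closure-good-all C class (proj₁ β-all)
    α-nonempty = All.map proj₂ α-good
    β-nonempty = All.map proj₂ β-good
    α-bounded = All.map (λ g → proj₂ (proj₁ g)) α-good
    β-bounded = All.map (λ g → proj₂ (proj₁ g)) β-good
    module IA = InflationBlocks π αs α-arity α-nonempty
    module IB = InflationBlocks π βs β-arity β-nonempty
    injσ : Inj (inflate π αs)
    injσ = IA.inflation-injective (isPerm⇒good π (proj₁ π-simple)) (All.map proj₁ α-good)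

-- Uniqueness of decomposition for ⊕ and ⊖: in α₁ ⊕ α₂ with α₁
-- sum-indecomposable, α₁ is the shortest nonempty prefix of the
-- permutation that is an interval of its smallest values; dually for ⊖.
module SumDecomposition where
  open Permutations
  open SimpleDecomposition using (closure-good)

  inflate-⊕ : ∀ (a b : List ℕ) → inflate ⊕perm (a ∷ b ∷ []) ≡ a ++ map (length a +_) b
  inflate-⊕ a b = cong₂ _++_ (List.map-id a)
    (Eq.trans (List.++-identityʳ _) (List.map-cong (λ x → cong (_+ x) (+-identityʳ (length a))) b))

  inflate-⊖ : ∀ (a b : List ℕ) → inflate ⊖perm (a ∷ b ∷ []) ≡ map (length b +_) a ++ b
  inflate-⊖ a b = cong₂ _++_ (List.map-cong (λ x → cong (_+ x) (+-identityʳ (length b))) a)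
    (Eq.trans (List.++-identityʳ _) (List.map-id b))

  ++-split : ∀ (xs ys zs ws : List ℕ) → length xs ≡ length ys → xs ++ zs ≡ ys ++ ws → xs ≡ ys × zs ≡ ws
  ++-split [] [] zs ws _ e = refl , e
  ++-split (x ∷ xs) (y ∷ ys) zs ws lengths e with List.∷-injective e
  ... | x≡y , rest = let (xs≡ys , zs≡ws) = ++-split xs ys zs ws (suc-injective lengths) rest in cong₂ _∷_ x≡y xs≡ys , zs≡ws

  ++-longer-prefix : ∀ (xs ys zs ws : List ℕ) → length xs ≤ length ys → xs ++ zs ≡ ys ++ ws
                   → ys ≡ xs ++ drop (length xs) ys × drop (length xs) ys ++ ws ≡ zs
  ++-longer-prefix [] ys zs ws _ e = refl , sym e
  ++-longer-prefix (x ∷ xs) (y ∷ ys) zs ws (s≤s xs≤ys) e with List.∷-injective e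
  ... | refl , rest = let (extends , remainder) = ++-longer-prefix xs ys zs ws xs≤ys rest in cong (x ∷_) extends , remainder

  take-length-++ : ∀ (xs ys : List ℕ) → take (length xs) (xs ++ ys) ≡ xs
  take-length-++ [] ys = refl
  take-length-++ (x ∷ xs) ys = cong (x ∷_) (take-length-++ xs ys)

  -- If a₁ ⊕ a₂ = b₁ ⊕ b₂ with a₁ strictly shorter than b₁, then b₁ = a₁ ⊕ γ
  -- for the prefix γ of a₂ that b₁ absorbs.
  longer-⊕-block-decomposes : ∀ a₁ a₂ b₁ b₂ → Good a₁ → 1 ≤ length a₁ → Good a₂ → Good b₁
    → length a₁ < length b₁ → a₁ ++ map (length a₁ +_) a₂ ≡ b₁ ++ map (length b₁ +_) b₂ → SumDec b₁
  longer-⊕-block-decomposes a₁ a₂ b₁ b₂ a₁-good a₁≥1 a₂-good b₁-good a₁<b₁ same =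
    a₁ , γ , (good⇒isPerm a₁ a₁-good , a₁≥1) , (good⇒isPerm γ γ-good , γ≥1) , b₁≡
    where
    ℓ = length a₁
    split = ++-longer-prefix a₁ b₁ (map (ℓ +_) a₂) (map (length b₁ +_) b₂) (<⇒≤ a₁<b₁) same
    d = length (drop ℓ b₁)
    γ = take d a₂
    rest≡ : drop ℓ b₁ ≡ map (ℓ +_) γ
    rest≡ = Eq.trans (sym (take-length-++ (drop ℓ b₁) _)) (Eq.trans (cong (take d) (proj₂ split)) (List.take-map d a₂))
    length-b₁ : length b₁ ≡ ℓ + d
    length-b₁ = Eq.trans (cong length (proj₁ split)) (List.length-++ a₁)
    length-γ : length γ ≡ d
    length-γ = Eq.trans (sym (List.length-map (ℓ +_) γ)) (cong length (sym rest≡))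
    γ≥1 : 1 ≤ length γ
    γ≥1 = Eq.subst (1 ≤_) (sym length-γ) (+-cancelˡ-≤ ℓ 1 d (Eq.subst (_≤ ℓ + d) (+-comm 1 ℓ) (Eq.subst (suc ℓ ≤_) length-b₁ a₁<b₁)))
    γ-bounded : ∀ {x} → x ∈ γ → x < length γ
    γ-bounded {x} x∈ = Eq.subst (x <_) (sym length-γ) (+-cancelˡ-< ℓ x d (Eq.subst (ℓ + x <_) length-b₁
      (All.lookup (proj₂ b₁-good) (Eq.subst (ℓ + x ∈_) (sym (proj₁ split))
        (∈-++⁺ʳ a₁ (Eq.subst (ℓ + x ∈_) (sym rest≡) (∈-map⁺ (ℓ +_) x∈)))))))
    γ-good : Good γ
    γ-good = take⁺ d (proj₁ a₂-good) , All.tabulate γ-bounded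
    b₁≡ : b₁ ≡ inflate ⊕perm (a₁ ∷ γ ∷ [])
    b₁≡ = Eq.trans (proj₁ split) (Eq.trans (cong (a₁ ++_) rest≡) (sym (inflate-⊕ a₁ γ)))

  -- If a₁ ⊖ a₂ = b₁ ⊖ b₂ with a₁ strictly shorter than b₁, then b₁ = a₁ ⊖ γ
  -- for the remainder γ of b₁ after a₁.
  longer-⊖-block-decomposes : ∀ a₁ a₂ b₁ b₂ → Good a₁ → 1 ≤ length a₁ → Good a₂ → Good b₁
    → length a₁ < length b₁ → map (length a₂ +_) a₁ ++ a₂ ≡ map (length b₂ +_) b₁ ++ b₂ → SkewDec b₁
  longer-⊖-block-decomposes a₁ a₂ b₁ b₂ a₁-good a₁≥1 a₂-good b₁-good a₁<b₁ same =
    a₁ , γ , (good⇒isPerm a₁ a₁-good , a₁≥1) , (good⇒isPerm γ γ-good , γ≥1) , b₁≡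
    where
    ℓ = length a₁
    X = map (length a₂ +_) a₁
    Y = map (length b₂ +_) b₁
    length-X : length X ≡ ℓ
    length-X = List.length-map _ a₁
    split = ++-longer-prefix X Y a₂ b₂
      (Eq.subst (_≤ length Y) (sym length-X) (Eq.subst (ℓ ≤_) (sym (List.length-map _ b₁)) (<⇒≤ a₁<b₁))) same
    γ = drop ℓ b₁
    rest≡ : drop (length X) Y ≡ map (length b₂ +_) γ
    rest≡ = Eq.trans (cong (λ k → drop k Y) length-X) (List.drop-map ℓ b₁)
    a₂≡ : a₂ ≡ map (length b₂ +_) γ ++ b₂
    a₂≡ = Eq.trans (sym (proj₂ split)) (cong (_++ b₂) rest≡)
    length-a₂ : length a₂ ≡ length γ + length b₂
    length-a₂ = Eq.trans (cong length a₂≡) (Eq.trans (List.length-++ (map _ γ)) (cong (_+ length b₂) (List.length-map _ γ)))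
    γ≥1 : 1 ≤ length γ
    γ≥1 = Eq.subst (1 ≤_) (sym (List.length-drop ℓ b₁))
      (Eq.subst (_≤ length b₁ ∸ ℓ) (m+n∸m≡n ℓ 1) (∸-monoˡ-≤ ℓ (Eq.subst (_≤ length b₁) (+-comm 1 ℓ) a₁<b₁)))
    γ-bounded : ∀ {x} → x ∈ γ → x < length γ
    γ-bounded {x} x∈ = +-cancelʳ-< (length b₂) x (length γ)
      (Eq.subst (_< length γ + length b₂) (+-comm (length b₂) x)
        (Eq.subst (length b₂ + x <_) length-a₂
          (All.lookup (proj₂ a₂-good) (Eq.subst (length b₂ + x ∈_) (sym a₂≡) (∈-++⁺ˡ (∈-map⁺ (length b₂ +_) x∈))))))
    γ-good : Good γ
    γ-good = drop⁺ ℓ (proj₁ b₁-good) , All.tabulate γ-bounded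
    shifted-b₁ : map (length b₂ +_) b₁ ≡ map (length b₂ +_) (map (length γ +_) a₁ ++ γ)
    shifted-b₁ = Eq.trans (proj₁ split) (Eq.trans (cong₂ _++_ shift-a₁ rest≡) (sym (List.map-++ (length b₂ +_) (map (length γ +_) a₁) γ)))
      where
      shift-a₁ : X ≡ map (length b₂ +_) (map (length γ +_) a₁)
      shift-a₁ = Eq.trans (List.map-cong (λ x → Eq.trans (cong (_+ x) (Eq.trans length-a₂ (+-comm (length γ) (length b₂))))
                                                     (+-assoc (length b₂) (length γ) x)) a₁)
                          (List.map-∘ a₁)
    b₁≡ : b₁ ≡ inflate ⊖perm (a₁ ∷ γ ∷ [])
    b₁≡ = Eq.trans (List.map-injective (+-cancelˡ-≡ (length b₂) _ _) shifted-b₁) (sym (inflate-⊖ a₁ γ))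

  module _ (C : Perm → Set) (class : IsClass C) where
    private
      good : ∀ {w} → Ĉ C w → Good w
      good w∈ = proj₁ (closure-good C class w∈)
      nonempty : ∀ {w} → Ĉ C w → 1 ≤ length w
      nonempty w∈ = proj₂ (closure-good C class w∈)

    -- uniqueness of decomposition for ⊕[Ĉ⁺, Ĉ] and ⊖[Ĉ⁻, Ĉ]: a shorter first block is impossible
    unique-⊕ : ∀ αs βs → Pointwise (Ĉδ C) (D.+ ∷ D.· ∷ []) αs → Pointwise (Ĉδ C) (D.+ ∷ D.· ∷ []) βs
             → inflate ⊕perm αs ≡ inflate ⊕perm βs → αs ≡ βs
    unique-⊕ (a₁ ∷ a₂ ∷ []) (b₁ ∷ b₂ ∷ []) ((a₁∈ , a₁-indec) ∷ a₂∈ ∷ []) ((b₁∈ , b₁-indec) ∷ b₂∈ ∷ []) same =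
      compare (Eq.trans (sym (inflate-⊕ a₁ a₂)) (Eq.trans same (inflate-⊕ b₁ b₂)))
      where
      compare : a₁ ++ map (length a₁ +_) a₂ ≡ b₁ ++ map (length b₁ +_) b₂ → a₁ ∷ a₂ ∷ [] ≡ b₁ ∷ b₂ ∷ []
      compare same′ with <-cmp (length a₁) (length b₁)
      ... | tri< a₁<b₁ _ _ = ⊥-elim (b₁-indec (longer-⊕-block-decomposes a₁ a₂ b₁ b₂ (good a₁∈) (nonempty a₁∈) (good a₂∈) (good b₁∈) a₁<b₁ same′))
      ... | tri> _ _ b₁<a₁ = ⊥-elim (a₁-indec (longer-⊕-block-decomposes b₁ b₂ a₁ a₂ (good b₁∈) (nonempty b₁∈) (good b₂∈) (good a₁∈) b₁<a₁ (sym same′)))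
      ... | tri≈ _ a₁≈b₁ _ with ++-split a₁ b₁ _ _ a₁≈b₁ same′
      ...   | refl , shifted = cong (λ b → a₁ ∷ b ∷ []) (List.map-injective (+-cancelˡ-≡ (length a₁) _ _) shifted)

    unique-⊖ : ∀ αs βs → Pointwise (Ĉδ C) (D.- ∷ D.· ∷ []) αs → Pointwise (Ĉδ C) (D.- ∷ D.· ∷ []) βs
             → inflate ⊖perm αs ≡ inflate ⊖perm βs → αs ≡ βs
    unique-⊖ (a₁ ∷ a₂ ∷ []) (b₁ ∷ b₂ ∷ []) ((a₁∈ , a₁-indec) ∷ a₂∈ ∷ []) ((b₁∈ , b₁-indec) ∷ b₂∈ ∷ []) same =
      compare (Eq.trans (sym (inflate-⊖ a₁ a₂)) (Eq.trans same (inflate-⊖ b₁ b₂)))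
      where
      compare : map (length a₂ +_) a₁ ++ a₂ ≡ map (length b₂ +_) b₁ ++ b₂ → a₁ ∷ a₂ ∷ [] ≡ b₁ ∷ b₂ ∷ []
      compare same′ with <-cmp (length a₁) (length b₁)
      ... | tri< a₁<b₁ _ _ = ⊥-elim (b₁-indec (longer-⊖-block-decomposes a₁ a₂ b₁ b₂ (good a₁∈) (nonempty a₁∈) (good a₂∈) (good b₁∈) a₁<b₁ same′))
      ... | tri> _ _ b₁<a₁ = ⊥-elim (a₁-indec (longer-⊖-block-decomposes b₁ b₂ a₁ a₂ (good b₁∈) (nonempty b₁∈) (good b₂∈) (good a₁∈) b₁<a₁ (sym same′)))
      ... | tri≈ _ a₁≈b₁ _ with ++-split (map (length a₂ +_) a₁) (map (length b₂ +_) b₁) a₂ b₂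
                                  (Eq.trans (List.length-map _ a₁) (Eq.trans a₁≈b₁ (sym (List.length-map _ b₁)))) same′
      ...   | shifted , refl = cong (λ a → a ∷ a₂ ∷ []) (List.map-injective (+-cancelˡ-≡ (length a₂) _ _) shifted)

module Splits where
  open PatternContainment using (_≼?_)

  Satisfies : Perm → List Perm × List Perm → Set
  Satisfies τ (E , A) = All (λ e → ¬ (e ≼ τ)) E × All (λ a → a ≼ τ) A

  SameUnion : List Perm × List Perm → List Perm × List Perm → Set
  SameUnion (E , A) (E' , A') = ∀ x → (x ∈ E ⊎ x ∈ A) ⇔ (x ∈ E' ⊎ x ∈ A')

  split-union : ∀ {EA EA'} → SplitOf EA EA' → SameUnion EA EA'
  split-union (_ , same) x = ⇔.sym (same x)

  splits-same-union : ∀ {EA X Y} → SplitOf EA X → SplitOf EA Y → SameUnion X Y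
  splits-same-union (_ , X≈EA) (_ , Y≈EA) x = ⇔.trans (X≈EA x) (⇔.sym (Y≈EA x))

  split-by : Perm → List Perm × List Perm → List Perm × List Perm
  split-by τ (E , A) = filter (λ e → ¬? (e ≼? τ)) (E ++ A) , filter (λ e → e ≼? τ) (E ++ A)

  split-by-is-split : ∀ τ EA → SplitOf EA (split-by τ EA)
  split-by-is-split τ (E , A) = disjoint , λ x → mk⇔ (to-union x) (from-union x)
    where
    avoided = filter (λ e → ¬? (e ≼? τ)) (E ++ A)
    contained = filter (λ e → e ≼? τ) (E ++ A)
    disjoint : Disjoint avoided contained
    disjoint x x∈avoided x∈contained =
      proj₂ (∈-filter⁻ (λ e → ¬? (e ≼? τ)) {xs = E ++ A} x∈avoided) (proj₂ (∈-filter⁻ (λ e → e ≼? τ) {xs = E ++ A} x∈contained))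
    to-union : ∀ x → x ∈ avoided ⊎ x ∈ contained → x ∈ E ⊎ x ∈ A
    to-union x (inj₁ x∈) = ∈-++⁻ E (proj₁ (∈-filter⁻ (λ e → ¬? (e ≼? τ)) {xs = E ++ A} x∈))
    to-union x (inj₂ x∈) = ∈-++⁻ E (proj₁ (∈-filter⁻ (λ e → e ≼? τ) {xs = E ++ A} x∈))
    in-union : ∀ {x} → x ∈ E ⊎ x ∈ A → x ∈ E ++ A
    in-union (inj₁ x∈E) = ∈-++⁺ˡ x∈E
    in-union (inj₂ x∈A) = ∈-++⁺ʳ E x∈A
    from-union : ∀ x → x ∈ E ⊎ x ∈ A → x ∈ avoided ⊎ x ∈ contained
    from-union x x∈ with x ≼? τ
    ... | yes x≼τ = inj₂ (∈-filter⁺ (λ e → e ≼? τ) (in-union x∈) x≼τ)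
    ... | no x⋠τ = inj₁ (∈-filter⁺ (λ e → ¬? (e ≼? τ)) (in-union x∈) x⋠τ)

  split-by-satisfied : ∀ τ EA → Satisfies τ (split-by τ EA)
  split-by-satisfied τ (E , A) = all-filter (λ e → ¬? (e ≼? τ)) (E ++ A) , all-filter (λ e → e ≼? τ) (E ++ A)

  satisfies? : ∀ τ EA → Dec (Satisfies τ EA)
  satisfies? τ (E , A) = all? (λ e → ¬? (e ≼? τ)) E ×-dec all? (λ a → a ≼? τ) A

  split-by-differs : ∀ τ EA → ¬ Satisfies τ EA → DiffPair (EA , split-by τ EA)
  split-by-differs τ (E , A) fails (same-E , same-A) = fails
    ( All.tabulate (λ e∈ → proj₂ (∈-filter⁻ (λ e → ¬? (e ≼? τ)) {xs = E ++ A} (to (same-E _) e∈)))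
    , All.tabulate (λ a∈ → proj₂ (∈-filter⁻ (λ e → e ≼? τ) {xs = E ++ A} (to (same-A _) a∈))))

  satisfied-split-unique : ∀ τ X Y → Satisfies τ X → Satisfies τ Y → SameUnion X Y → SamePair X Y
  satisfied-split-unique τ X Y τ⊨X τ⊨Y same = (λ x → mk⇔ (avoided-kept X Y τ⊨X τ⊨Y same x) (avoided-kept Y X τ⊨Y τ⊨X (flip same) x))
                                           , (λ x → mk⇔ (contained-kept X Y τ⊨X τ⊨Y same x) (contained-kept Y X τ⊨Y τ⊨X (flip same) x))
    where
    flip : ∀ {X Y} → SameUnion X Y → SameUnion Y X
    flip same x = ⇔.sym (same x)
    avoided-kept : ∀ X Y → Satisfies τ X → Satisfies τ Y → SameUnion X Y → ∀ x → x ∈ proj₁ X → x ∈ proj₁ Y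
    avoided-kept (E , A) (E' , A') (avoids-E , _) (_ , contains-A') same x x∈E with to (same x) (inj₁ x∈E)
    ... | inj₁ x∈E' = x∈E'
    ... | inj₂ x∈A' = ⊥-elim (All.lookup avoids-E x∈E (All.lookup contains-A' x∈A'))
    contained-kept : ∀ X Y → Satisfies τ X → Satisfies τ Y → SameUnion X Y → ∀ x → x ∈ proj₂ X → x ∈ proj₂ Y
    contained-kept (E , A) (E' , A') (_ , contains-A) (avoids-E' , _) same x x∈A with to (same x) (inj₂ x∈A)
    ... | inj₂ x∈A' = x∈A'
    ... | inj₁ x∈E' = ⊥-elim (All.lookup avoids-E' x∈E' (All.lookup contains-A x∈A))

module Terms (C : Perm → Set) where
  open Splits

  length-signs : ∀ s → length (signs s) ≡ arity s
  length-signs (simple π _) = List.length-replicate (length π)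
  length-signs ⊕s = refl
  length-signs ⊖s = refl

  unique-decomposition : IsClass C → (s : Shape) → ∀ αs βs → Pointwise (Ĉδ C) (signs s) αs → Pointwise (Ĉδ C) (signs s) βs
                       → inflate (shapePerm s) αs ≡ inflate (shapePerm s) βs → αs ≡ βs
  unique-decomposition class (simple π π-simple) = SimpleDecomposition.unique-simple C class π π-simple
  unique-decomposition class ⊕s = SumDecomposition.unique-⊕ C class
  unique-decomposition class ⊖s = SumDecomposition.unique-⊖ C class

  blocks-in-closure : ∀ ds spec ps → length spec ≡ length ds → Pointwise (RestrAt C) (zip ds spec) ps → Pointwise (Ĉδ C) ds ps
  blocks-in-closure [] [] [] _ [] = []
  blocks-in-closure (d ∷ ds) (EA ∷ spec) (p ∷ ps) arity (p∈ ∷ ps∈) = proj₁ p∈ ∷ blocks-in-closure ds spec ps (suc-injective arity) ps∈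

  canonical-splits : ∀ ds spec ps → length spec ≡ length ds → Pointwise (Ĉδ C) ds ps
                   → IsSplit spec (zipWith split-by ps spec) × Pointwise (RestrAt C) (zip ds (zipWith split-by ps spec)) ps
  canonical-splits [] [] [] _ [] = [] , []
  canonical-splits (d ∷ ds) (EA ∷ spec) (p ∷ ps) arity (p∈ ∷ ps∈) =
    let (splits , satisfied) = canonical-splits ds spec ps (suc-injective arity) ps∈
    in split-by-is-split p EA ∷ splits , (p∈ , split-by-satisfied p EA) ∷ satisfied

  canonical-differs : ∀ ds spec ps → length spec ≡ length ds → Pointwise (Ĉδ C) ds ps
                    → ¬ Pointwise (RestrAt C) (zip ds spec) ps → Differs spec (zipWith split-by ps spec)
  canonical-differs [] [] [] _ [] fails = ⊥-elim (fails [])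
  canonical-differs (d ∷ ds) (EA ∷ spec) (p ∷ ps) arity (p∈ ∷ ps∈) fails with satisfies? p EA
  ... | yes p⊨EA = there (canonical-differs ds spec ps (suc-injective arity) ps∈ (λ ps⊨ → fails ((p∈ , p⊨EA) ∷ ps⊨)))
  ... | no p⊭EA = here (split-by-differs p EA p⊭EA)

  same-blocks-same-spec : ∀ ds X Y ps → length X ≡ length ds → Pointwise SameUnion X Y
                        → Pointwise (RestrAt C) (zip ds X) ps → Pointwise (RestrAt C) (zip ds Y) ps → SameSpec X Y
  same-blocks-same-spec [] [] [] [] _ [] [] [] = []
  same-blocks-same-spec (d ∷ ds) (x ∷ X) (y ∷ Y) (p ∷ ps) arity (u ∷ us) (p⊨x ∷ ps⊨X) (p⊨y ∷ ps⊨Y) =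
    satisfied-split-unique p x y (proj₂ p⊨x) (proj₂ p⊨y) u ∷ same-blocks-same-spec ds X Y ps (suc-injective arity) us ps⊨X ps⊨Y

  same-term-same-spec : IsClass C → ∀ s spec spec' σ → length spec ≡ arity s → Pointwise SameUnion spec spec'
                      → Term C s spec σ → Term C s spec' σ → SameSpec spec spec'
  same-term-same-spec class s spec spec' σ arity unions (πs , πs⊨ , σ≡) (πs' , πs'⊨ , σ≡') =
    same-blocks-same-spec (signs s) spec spec' πs arity≡ unions πs⊨ (Eq.subst (Pointwise (RestrAt C) (zip (signs s) spec')) (sym same-blocks) πs'⊨)
    where
    arity≡ : length spec ≡ length (signs s)
    arity≡ = Eq.trans arity (sym (length-signs s))
    same-blocks : πs ≡ πs'
    same-blocks = unique-decomposition class s πs πs' (blocks-in-closure (signs s) spec πs arity≡ πs⊨)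
      (blocks-in-closure (signs s) spec' πs' (Eq.trans (sym (Pointwise-length unions)) arity≡) πs'⊨) (Eq.trans (sym σ≡) σ≡')

  no-difference : ∀ {X Y} → SameSpec X Y → ¬ Differs X Y
  no-difference (same ∷ _) (here different) = different same
  no-difference (_ ∷ sames) (there difference) = no-difference sames difference

-- Proposition 6.11.
proposition6p11 : (C : Perm → Set) → IsClass C → C ⊕perm → C ⊖perm →
    (s : Shape) (spec : Spec) → length spec ≡ arity s → All WellFormedEA spec →
    ((σ : Perm) → Complement C s spec σ ⇔ (∃ λ spec' → IsSplit spec spec' × Differs spec spec' × Term C s spec' σ))
    × ((spec' spec'' : Spec) (σ : Perm) → IsSplit spec spec' → IsSplit spec spec'' →
       Term C s spec' σ → Term C s spec'' σ → SameSpec spec' spec'')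
proposition6p11 C class _ _ s spec arity _ = (λ σ → mk⇔ covered uncovered) , disjoint
  where
  open Splits
  open Terms C
  arity≡ : length spec ≡ length (signs s)
  arity≡ = Eq.trans arity (sym (length-signs s))
  -- σ ∈ t̄ lies in the term given by the canonical splits of its blocks
  covered : ∀ {σ} → Complement C s spec σ → ∃ λ spec' → IsSplit spec spec' × Differs spec spec' × Term C s spec' σ
  covered ((πs , πs∈ , σ≡) , σ∉t) =
    let (splits , satisfied) = canonical-splits (signs s) spec πs arity≡ πs∈
    in zipWith split-by πs spec , splits , canonical-differs (signs s) spec πs arity≡ πs∈ (λ πs⊨ → σ∉t (πs , πs⊨ , σ≡)) , πs , satisfied , σ≡
  -- a term with a different split cannot meet t, by uniqueness of the blocks
  uncovered : ∀ {σ} → (∃ λ spec' → IsSplit spec spec' × Differs spec spec' × Term C s spec' σ) → Complement C s spec σ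
  uncovered (spec' , splits , differs , σ∈t'@(πs , πs⊨ , σ≡)) =
      (πs , blocks-in-closure (signs s) spec' πs (Eq.trans (sym (Pointwise-length splits)) arity≡) πs⊨ , σ≡)
    , λ σ∈t → no-difference (same-term-same-spec class s spec spec' _ arity (Pointwise.map split-union splits) σ∈t σ∈t') differs
  disjoint : (spec' spec'' : Spec) (σ : Perm) → IsSplit spec spec' → IsSplit spec spec''
           → Term C s spec' σ → Term C s spec'' σ → SameSpec spec' spec''
  disjoint spec' spec'' σ splits' splits'' =
    same-term-same-spec class s spec' spec'' σ (Eq.trans (sym (Pointwise-length splits')) arity) (same-unions splits' splits'')
    where
    same-unions : ∀ {X Y Z} → IsSplit X Y → IsSplit X Z → Pointwise SameUnion Y Z
    same-unions [] [] = []
    same-unions (y ∷ ys) (z ∷ zs) = splits-same-union y z ∷ same-unions ys zs
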